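{- Let $m\ge 2$, $k\ge1$, $D=\{1,-1,\dots,m,-m\}$, and let $\Gamma$ be a finite vertex-transitive graph with vertex set $D\times[k]$. Assume $\mathrm{Aut}(\Gamma)$ contains a group $G$ with $E^k\le G\le Y\wr\mathrm{Sym}(k)$ for some $Y\le C_2\wr\mathrm{Sym}(m)$. If $m\ge3$, then $\mu(\Gamma)=2$.
   Context: $[k]=\{1,\dots,k\}$. $C_2\wr\mathrm{Sym}(m)$ is the group of permutations of $D$ of the form $\varepsilon i\mapsto\varepsilon v_i\,\sigma(i)$ with $(v_1,\dots,v_m)\in\{1,-1\}^m$ and $\sigma\in\mathrm{Sym}(m)$. $E$ is its subgroup of elements with $\sigma=1$ and an even number of $v_i=-1$. $Y\wr\mathrm{Sym}(k)$ acts on $D\times[k]$ by $(\delta,j)^{((y_1,\dots,y_k),h)}=(\delta^{y_j},j^h)$, and $E^k=\{((e_1,\dots,e_k),1):e_j\in E\}$. $\mu(\Gamma)$ is the motion: the minimum number of vertices moved by a non-identity automorphism. -}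

module Defs where

open import Data.Bool using (Bool; true; false; not; _xor_; if_then_else_)
open import Data.Bool.Properties using () renaming (_≟_ to _≟B_)
open import Data.Nat using (ℕ; _≤_; _+_)
open import Data.Nat.Divisibility using (_∣_)
open import Data.Fin using (Fin) renaming (_≟_ to _≟F_)
open import Data.Nat.ListAction using (sum)
open import Data.List using (List; map; allFin; cartesianProduct)
open import Data.Product using (Σ; ∃; _×_; _,_)
open import Data.Product.Properties using (≡-dec)
open import Function using (id; _∘_)
open import Function.Bundles using (_↔_; Inverse)
open import Relation.Binary.PropositionalEquality using (_≡_; _≢_)
open import Relation.Nullary using (¬_; does)

Perm : Set → Set
Perm X = X ↔ X

open Inverse public using (to; from)

-- A subgroup of Sym(X), given as a predicate on permutations, closed under
-- identity, composition and inverses (and hence under pointwise equality).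
record IsSubgroup {X : Set} (P : Perm X → Set) : Set₁ where
  field
    has-id  : ∀ (h : Perm X) → (∀ x → to h x ≡ x) → P h
    has-∘   : ∀ (f g h : Perm X) → P f → P g → (∀ x → to h x ≡ to f (to g x)) → P h
    has-inv : ∀ (f h : Perm X) → P f → (∀ x → to h x ≡ from f x) → P h

-- Signs: true = +1, false = -1.  Multiplication of signs is ¬xor.
Sign : Set
Sign = Bool

_·_ : Sign → Sign → Sign
a · b = not (a xor b)

-- D = {1,-1,...,m,-m}; the element εi is represented by (ε , i).
D : ℕ → Set
D m = Sign × Fin m

InC2wrSym : (m : ℕ) → Perm (D m) → Set
InC2wrSym m p = Σ (Fin m → Sign) λ v → Σ (Perm (Fin m)) λ σ →
  ∀ (ε : Sign) (i : Fin m) → to p (ε , i) ≡ (ε · v i , to σ i)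

negCount : (m : ℕ) → (Fin m → Sign) → ℕ
negCount m v = sum (map (λ i → if v i then 0 else 1) (allFin m))

InE : (m : ℕ) → Perm (D m) → Set
InE m p = Σ (Fin m → Sign) λ v → 2 ∣ negCount m v ×
  (∀ (ε : Sign) (i : Fin m) → to p (ε , i) ≡ (ε · v i , i))

V : ℕ → ℕ → Set
V m k = D m × Fin k

InEk : (m k : ℕ) → Perm (V m k) → Set
InEk m k p = Σ (Fin k → Perm (D m)) λ e → (∀ j → InE m (e j)) ×
  (∀ (δ : D m) (j : Fin k) → to p (δ , j) ≡ (to (e j) δ , j))

InWr : (m k : ℕ) → (Perm (D m) → Set) → Perm (V m k) → Set
InWr m k Y p = Σ (Fin k → Perm (D m)) λ y → (∀ j → Y (y j)) ×
  Σ (Perm (Fin k)) λ h →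
  (∀ (δ : D m) (j : Fin k) → to p (δ , j) ≡ (to (y j) δ , to h j))

record Graph (X : Set) : Set where
  field
    adj   : X → X → Bool
    sym   : ∀ x y → adj x y ≡ adj y x
    irrefl : ∀ x → adj x x ≡ false
open Graph public

IsAut : {X : Set} → Graph X → Perm X → Set
IsAut Γ p = ∀ x y → adj Γ (to p x) (to p y) ≡ adj Γ x y

VertexTransitive : {X : Set} → Graph X → Set
VertexTransitive {X} Γ = ∀ (x y : X) → Σ (Perm X) λ p → IsAut Γ p × to p x ≡ y

allD : (m : ℕ) → List (D m)
allD m = cartesianProduct (true Data.List.∷ false Data.List.∷ Data.List.[]) (allFin m)

allV : (m k : ℕ) → List (V m k)
allV m k = cartesianProduct (allD m) (allFin k)

_≟V_ : {m k : ℕ} → (x y : V m k) → _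
_≟V_ = ≡-dec (≡-dec _≟B_ _≟F_) _≟F_

moved : (m k : ℕ) → Perm (V m k) → ℕ
moved m k p = sum (map (λ x → if does (to p x ≟V x) then 0 else 1) (allV m k))

NonIdentity : {X : Set} → Perm X → Set
NonIdentity {X} p = Σ X λ x → to p x ≢ x

MotionIs : (m k : ℕ) → Graph (V m k) → ℕ → Set
MotionIs m k Γ n =
  (Σ (Perm (V m k)) λ p → IsAut Γ p × NonIdentity p × moved m k p ≡ n) ×
  (∀ (p : Perm (V m k)) → IsAut Γ p → NonIdentity p → n ≤ moved m k p)

{-# OPTIONS --safe #-}
-- Fix a block j₀ and a coordinate c, and let τ be the transposition of the vertices +c and −c
-- of that block.  These two vertices are twins: given any other vertex y, with coordinate i,
-- m ≥ 3 leaves a coordinate d outside {c, i}, and the element of E^k changing the signs of c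
-- and d in block j₀ is an automorphism sending +c to −c and fixing y.  Hence τ is an
-- automorphism; it moves exactly two vertices, and no non-identity permutation moves fewer.
module Submission where

open import Defs hiding (sym)
open import Data.Bool using (true; false; not; T; if_then_else_)
open import Data.Empty using (⊥-elim)
open import Data.Fin using (Fin; zero; suc; fromℕ<) renaming (_≟_ to _≟F_)
open import Data.List using (List; []; _∷_; map; allFin; length)
open import Data.List.Membership.Propositional using (_∈_)
open import Data.List.Membership.Propositional.Properties using (∈-cartesianProduct⁺; ∈-allFin)
open import Data.List.Properties using (length-removeAt′)
open import Data.List.Relation.Unary.All using ([]; _∷_) renaming (lookup to All-lookup)
open import Data.List.Relation.Unary.AllPairs using ([]; _∷_)
open import Data.List.Relation.Unary.Any using (here; there; index; _─_)
open import Data.List.Relation.Unary.Unique.Propositional using (Unique)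
open import Data.List.Relation.Unary.Unique.Propositional.Properties using (cartesianProduct⁺; allFin⁺)
open import Data.Nat using (ℕ; _≤_; _+_; z≤n; s≤s; z<s)
open import Data.Nat.ListAction using (sum)
open import Data.Nat.Divisibility using (_∣_; _∣0; ∣-reflexive)
open import Data.Nat.Properties using (≤-trans; ≤-antisym; m≤n+m; <-≤-trans)
open import Data.Product using (∃-syntax; _×_; _,_)
open import Data.Sum using (_⊎_; inj₁; inj₂; [_,_]′)
open import Function using (_∘_)
open import Function.Bundles using (Injection; Inverse; mk↔ₛ′)
open import Function.Properties.Inverse using (↔⇒↣)
open import Relation.Binary.Definitions using (DecidableEquality)
open import Relation.Binary.PropositionalEquality
  using (_≡_; _≢_; refl; sym; trans; cong; cong₂; subst; ≢-sym; module ≡-Reasoning)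
open import Relation.Nullary using (¬_; yes; no; does)
open import Relation.Nullary.Decidable
  using (_⊎-dec_; T?; dec-true; dec-false; decidable-stable)
open import Relation.Unary using (Pred; Decidable)

private
  variable
    m k : ℕ

∈-─⁺ : ∀ {a} {A : Set a} {x z : A} {xs} (z∈xs : z ∈ xs) → x ∈ xs → x ≢ z → x ∈ (xs ─ z∈xs)
∈-─⁺ (here refl)  (here refl)  x≢z = ⊥-elim (x≢z refl)
∈-─⁺ (here refl)  (there x∈xs) _   = x∈xs
∈-─⁺ (there _)    (here refl)  _   = here refl
∈-─⁺ (there z∈xs) (there x∈xs) x≢z = there (∈-─⁺ z∈xs x∈xs x≢z)

module _ {a ℓ} {A : Set a} {P : Pred A ℓ} (P? : Decidable P) where

  failures : List A → ℕ
  failures xs = sum (map (λ x → if does (P? x) then 0 else 1) xs)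

  failures-≡0 : (∀ x → P x) → ∀ xs → failures xs ≡ 0
  failures-≡0 all-P []       = refl
  failures-≡0 all-P (x ∷ xs) rewrite dec-true (P? x) (all-P x) = failures-≡0 all-P xs

  failures-≥1 : ∀ {x xs} → x ∈ xs → ¬ P x → 1 ≤ failures xs
  failures-≥1 {xs = z ∷ _} (here refl) ¬Pz rewrite dec-false (P? z) ¬Pz = s≤s z≤n
  failures-≥1 {xs = z ∷ _} (there x∈zs) ¬Px = ≤-trans (failures-≥1 x∈zs ¬Px) (m≤n+m _ _)

  failures-≥2 : ∀ {x y xs} → x ∈ xs → y ∈ xs → x ≢ y → ¬ P x → ¬ P y → 2 ≤ failures xs
  failures-≥2 (here refl) (here refl) x≢y _ _ = ⊥-elim (x≢y refl)
  failures-≥2 {xs = z ∷ _} (here refl) (there y∈zs) _ ¬Pz ¬Py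
    rewrite dec-false (P? z) ¬Pz = s≤s (failures-≥1 y∈zs ¬Py)
  failures-≥2 {xs = z ∷ _} (there x∈zs) (here refl) _ ¬Px ¬Pz
    rewrite dec-false (P? z) ¬Pz = s≤s (failures-≥1 x∈zs ¬Px)
  failures-≥2 {xs = z ∷ _} (there x∈zs) (there y∈zs) x≢y ¬Px ¬Py =
    ≤-trans (failures-≥2 x∈zs y∈zs x≢y ¬Px ¬Py) (m≤n+m _ _)

  failures-≤-length : ∀ {xs} ys → Unique xs → (∀ {x} → x ∈ xs → ¬ P x → x ∈ ys) →
                      failures xs ≤ length ys
  failures-≤-length ys [] _ = z≤n
  failures-≤-length {z ∷ zs} ys (z∉zs ∷ zs!) support with P? z
  ... | yes _   = failures-≤-length ys zs! (support ∘ there)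
  ... | no ¬Pz  = subst (1 + failures zs ≤_) (sym (length-removeAt′ ys (index z∈ys)))
                    (s≤s (failures-≤-length (ys ─ z∈ys) zs! support′))
    where
    z∈ys : z ∈ ys
    z∈ys = support (here refl) ¬Pz
    support′ : ∀ {x} → x ∈ zs → ¬ P x → x ∈ (ys ─ z∈ys)
    support′ x∈zs ¬Px = ∈-─⁺ z∈ys (support (there x∈zs) ¬Px) (≢-sym (All-lookup z∉zs x∈zs))

  failures-≡2 : ∀ {x y xs} → Unique xs → x ∈ xs → y ∈ xs → x ≢ y → ¬ P x → ¬ P y →
                (∀ {z} → ¬ P z → z ≡ x ⊎ z ≡ y) → failures xs ≡ 2
  failures-≡2 {x} {y} xs! x∈xs y∈xs x≢y ¬Px ¬Py support =
    ≤-antisym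
      (failures-≤-length (x ∷ y ∷ []) xs! (λ _ ¬Pz → [ here , there ∘ here ]′ (support ¬Pz)))
              (failures-≥2 x∈xs y∈xs x≢y ¬Px ¬Py)


adj-loops : ∀ {A : Set} (Γ : Graph A) u v → adj Γ u u ≡ adj Γ v v
adj-loops Γ u v = trans (irrefl Γ u) (sym (irrefl Γ v))

module Transposition {A : Set} (_≟_ : DecidableEquality A) (a b : A) where

  swap : A → A
  swap x = if does (x ≟ a) then b else if does (x ≟ b) then a else x

  swap-a : swap a ≡ b
  swap-a rewrite dec-true (a ≟ a) refl = refl

  swap-b : swap b ≡ a
  swap-b with b ≟ a
  ... | yes b≡a = b≡a
  ... | no _ rewrite dec-true (b ≟ b) refl = refl

  swap-other : ∀ {x} → x ≢ a → x ≢ b → swap x ≡ x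
  swap-other {x} x≢a x≢b rewrite dec-false (x ≟ a) x≢a | dec-false (x ≟ b) x≢b = refl

  classify : ∀ x → x ≡ a ⊎ x ≡ b ⊎ (x ≢ a × x ≢ b)
  classify x with x ≟ a | x ≟ b
  ... | yes x≡a | _       = inj₁ x≡a
  ... | no _    | yes x≡b = inj₂ (inj₁ x≡b)
  ... | no x≢a  | no x≢b  = inj₂ (inj₂ (x≢a , x≢b))

  swap-involutive : ∀ x → swap (swap x) ≡ x
  swap-involutive x with classify x
  ... | inj₁ refl               = trans (cong swap swap-a) swap-b
  ... | inj₂ (inj₁ refl)        = trans (cong swap swap-b) swap-a
  ... | inj₂ (inj₂ (x≢a , x≢b)) = trans (cong swap (swap-other x≢a x≢b)) (swap-other x≢a x≢b)

  transposition : Perm A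
  transposition = mk↔ₛ′ swap swap swap-involutive swap-involutive

  transposition-moves-a : a ≢ b → to transposition a ≢ a
  transposition-moves-a a≢b τa≡a = a≢b (trans (sym τa≡a) swap-a)

  transposition-moves-b : a ≢ b → to transposition b ≢ b
  transposition-moves-b a≢b τb≡b = a≢b (trans (sym swap-b) τb≡b)

  transposition-support : ∀ {x} → to transposition x ≢ x → x ≡ a ⊎ x ≡ b
  transposition-support {x} τx≢x with classify x
  ... | inj₁ x≡a                = inj₁ x≡a
  ... | inj₂ (inj₁ x≡b)         = inj₂ x≡b
  ... | inj₂ (inj₂ (x≢a , x≢b)) = ⊥-elim (τx≢x (swap-other x≢a x≢b))

  transposition-isAut : (Γ : Graph A) → (∀ y → y ≢ a → y ≢ b → adj Γ a y ≡ adj Γ b y) →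
                        IsAut Γ transposition
  transposition-isAut Γ twins x y with classify x | classify y
  ... | inj₁ refl | inj₁ refl rewrite swap-a = adj-loops Γ b a
  ... | inj₁ refl | inj₂ (inj₁ refl) rewrite swap-a | swap-b = Graph.sym Γ b a
  ... | inj₁ refl | inj₂ (inj₂ (y≢a , y≢b)) rewrite swap-a | swap-other y≢a y≢b =
    sym (twins y y≢a y≢b)
  ... | inj₂ (inj₁ refl) | inj₁ refl rewrite swap-b | swap-a = Graph.sym Γ a b
  ... | inj₂ (inj₁ refl) | inj₂ (inj₁ refl) rewrite swap-b = adj-loops Γ a b
  ... | inj₂ (inj₁ refl) | inj₂ (inj₂ (y≢a , y≢b)) rewrite swap-b | swap-other y≢a y≢b =
    twins y y≢a y≢b
  ... | inj₂ (inj₂ (x≢a , x≢b)) | inj₁ refl rewrite swap-a | swap-other x≢a x≢b =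
    trans (Graph.sym Γ x b) (trans (sym (twins x x≢a x≢b)) (Graph.sym Γ a x))
  ... | inj₂ (inj₂ (x≢a , x≢b)) | inj₂ (inj₁ refl) rewrite swap-b | swap-other x≢a x≢b =
    trans (Graph.sym Γ x a) (trans (twins x x≢a x≢b) (Graph.sym Γ b x))
  ... | inj₂ (inj₂ (x≢a , x≢b)) | inj₂ (inj₂ (y≢a , y≢b))
    rewrite swap-other x≢a x≢b | swap-other y≢a y≢b = refl

∈-allV : ∀ (x : V m k) → x ∈ allV m k
∈-allV ((ε , i) , j) =
  ∈-cartesianProduct⁺ (∈-cartesianProduct⁺ (∈-signs ε) (∈-allFin i)) (∈-allFin j)
  where
  ∈-signs : ∀ ε → ε ∈ true ∷ false ∷ []
  ∈-signs true  = here refl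
  ∈-signs false = there (here refl)

allV-unique : ∀ m k → Unique (allV m k)
allV-unique m k = cartesianProduct⁺ (cartesianProduct⁺ signs-unique (allFin⁺ m)) (allFin⁺ k)
  where
  signs-unique : Unique (true ∷ false ∷ [])
  signs-unique = ((λ ()) ∷ []) ∷ [] ∷ []

moved-≥2 : ∀ (p : Perm (V m k)) → NonIdentity p → 2 ≤ moved m k p
moved-≥2 p (x , px≢x) =
  failures-≥2 (λ x → to p x ≟V x) (∈-allV x) (∈-allV (to p x))
    (≢-sym px≢x) px≢x (px≢x ∘ Injection.injective (↔⇒↣ p))

moved-transposition : ∀ {a b : V m k} → a ≢ b → moved m k (Transposition.transposition _≟V_ a b) ≡ 2
moved-transposition {m} {k} {a} {b} a≢b =
  failures-≡2 (λ x → to transposition x ≟V x) (allV-unique m k) (∈-allV a) (∈-allV b) a≢b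
    (transposition-moves-a a≢b) (transposition-moves-b a≢b) transposition-support
  where open Transposition _≟V_ a b

·-involutive : ∀ s ε → (ε · s) · s ≡ ε
·-involutive true  true  = refl
·-involutive true  false = refl
·-involutive false true  = refl
·-involutive false false = refl

T⇒·-identityʳ : ∀ {s} ε → T s → ε · s ≡ ε
T⇒·-identityʳ {true} true  _ = refl
T⇒·-identityʳ {true} false _ = refl

¬T⇒·≡not : ∀ {s} ε → ¬ T s → ε · s ≡ not ε
¬T⇒·≡not {false} true  _   = refl
¬T⇒·≡not {false} false _   = refl
¬T⇒·≡not {true}  _     ¬tt = ⊥-elim (¬tt _)

signChange : (Fin m → Sign) → Perm (D m)
signChange v = mk↔ₛ′ flip flip flip-involutive flip-involutive
  where
  flip : D _ → D _
  flip (ε , i) = (ε · v i , i)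
  flip-involutive : ∀ δ → flip (flip δ) ≡ δ
  flip-involutive (ε , i) = cong (_, i) (·-involutive (v i) ε)

signChange-∈E : ∀ {v : Fin m → Sign} → 2 ∣ negCount m v → InE m (signChange v)
signChange-∈E {v = v} even = v , even , λ _ _ → refl

blockwise : (Fin k → Perm (D m)) → Perm (V m k)
blockwise e = mk↔ₛ′ (λ (δ , j) → (to (e j) δ , j)) (λ (δ , j) → (from (e j) δ , j))
  (λ (δ , j) → cong (_, j) (Inverse.strictlyInverseˡ (e j) δ))
  (λ (δ , j) → cong (_, j) (Inverse.strictlyInverseʳ (e j) δ))

blockwise-∈Eᵏ : ∀ {e : Fin k → Perm (D m)} → (∀ j → InE m (e j)) → InEk m k (blockwise e)
blockwise-∈Eᵏ {e = e} e∈E = e , e∈E , λ _ _ → refl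

pairFlip : Fin m → Fin m → Fin m → Sign
pairFlip c d i = not (does (i ≟F c ⊎-dec i ≟F d))

pairFlip-flips : ∀ {c d i : Fin m} → i ≡ c ⊎ i ≡ d → ¬ T (pairFlip c d i)
pairFlip-flips {c = c} {d} {i} i∈cd rewrite dec-true (i ≟F c ⊎-dec i ≟F d) i∈cd = λ ()

pairFlip-fixes : ∀ {c d i : Fin m} → ¬ (i ≡ c ⊎ i ≡ d) → T (pairFlip c d i)
pairFlip-fixes {c = c} {d} {i} i∉cd rewrite dec-false (i ≟F c ⊎-dec i ≟F d) i∉cd = _

pairFlip-support : ∀ {c d i : Fin m} → ¬ T (pairFlip c d i) → i ≡ c ⊎ i ≡ d
pairFlip-support {c = c} {d} {i} ¬t = decidable-stable (i ≟F c ⊎-dec i ≟F d) (¬t ∘ pairFlip-fixes)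

negCount-pairFlip : ∀ {c d : Fin m} → c ≢ d → negCount m (pairFlip c d) ≡ 2
negCount-pairFlip {m} {c} {d} c≢d =
  failures-≡2 (T? ∘ pairFlip c d) (allFin⁺ m) (∈-allFin c) (∈-allFin d) c≢d
    (pairFlip-flips {c = c} {d} (inj₁ refl)) (pairFlip-flips {c = c} {d} (inj₂ refl))
    pairFlip-support

inBlock : Fin k → (Fin m → Sign) → Fin k → Fin m → Sign
inBlock j₀ v j i = if does (j ≟F j₀) then v i else true

negCount-inBlock : ∀ {j₀ : Fin k} {v : Fin m → Sign} → 2 ∣ negCount m v →
                   ∀ j → 2 ∣ negCount m (inBlock j₀ v j)
negCount-inBlock {m = m} {j₀ = j₀} even j with j ≟F j₀
... | yes _ = even
... | no _  = subst (2 ∣_) (sym (failures-≡0 (λ _ → T? true) _ (allFin m))) (2 ∣0)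

inBlock-flips : ∀ {j₀ : Fin k} {v : Fin m → Sign} {i} → ¬ T (v i) → ¬ T (inBlock j₀ v j₀ i)
inBlock-flips {j₀ = j₀} ¬t rewrite dec-true (j₀ ≟F j₀) refl = ¬t

inBlock-fixes : ∀ {j₀ j : Fin k} {v : Fin m → Sign} {i} → (j ≡ j₀ → T (v i)) → T (inBlock j₀ v j i)
inBlock-fixes {j₀ = j₀} {j} t with j ≟F j₀
... | yes j≡j₀ = t j≡j₀
... | no _     = _

third-element : 3 ≤ m → (c i : Fin m) → ∃[ d ] c ≢ d × i ≢ d
third-element (s≤s (s≤s (s≤s _))) = λ where
  (suc _)       (suc _)       → zero , (λ ()) , (λ ())
  zero          zero          → suc zero , (λ ()) , (λ ())
  zero          (suc zero)    → suc (suc zero) , (λ ()) , (λ ())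
  zero          (suc (suc _)) → suc zero , (λ ()) , (λ ())
  (suc zero)    zero          → suc (suc zero) , (λ ()) , (λ ())
  (suc (suc _)) zero          → suc zero , (λ ()) , (λ ())

off-pair : ∀ {c i : Fin m} {j₀ j : Fin k} ε →
           ((ε , i) , j) ≢ ((true , c) , j₀) → ((ε , i) , j) ≢ ((false , c) , j₀) →
           j ≡ j₀ → i ≢ c
off-pair true  ≢+c _   refl refl = ≢+c refl
off-pair false _   ≢-c refl refl = ≢-c refl

signed-twins : (Γ : Graph (V m k)) → (∀ p → InEk m k p → IsAut Γ p) → 3 ≤ m →
               ∀ j₀ c y → y ≢ ((true , c) , j₀) → y ≢ ((false , c) , j₀) →
               adj Γ ((true , c) , j₀) y ≡ adj Γ ((false , c) , j₀) y
signed-twins {m} {k} Γ Eᵏ≤Aut 3≤m j₀ c y@((ε , i) , j) y≢+c y≢-c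
  with d , c≢d , i≢d ← third-element 3≤m c i = begin
  adj Γ (+c) y                 ≡⟨ sym (Eᵏ≤Aut g g∈Eᵏ +c y) ⟩
  adj Γ (to g +c) (to g y)     ≡⟨ cong₂ (adj Γ) g-flips-c g-fixes-y ⟩
  adj Γ (-c) y                 ∎
  where
  open ≡-Reasoning
  +c -c : V m k
  +c = ((true , c) , j₀)
  -c = ((false , c) , j₀)
  w : Fin k → Fin m → Sign
  w = inBlock j₀ (pairFlip c d)
  g : Perm (V m k)
  g = blockwise (signChange ∘ w)
  g∈Eᵏ : InEk m k g
  g∈Eᵏ = blockwise-∈Eᵏ {e = signChange ∘ w} λ j → signChange-∈E
    (negCount-inBlock {j₀ = j₀} {v = pairFlip c d} (∣-reflexive (sym (negCount-pairFlip c≢d))) j)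
  w-flips-c : ¬ T (w j₀ c)
  w-flips-c =
    inBlock-flips {j₀ = j₀} {v = pairFlip c d} {c} (pairFlip-flips {c = c} {d} (inj₁ refl))
  w-fixes-y : T (w j i)
  w-fixes-y = inBlock-fixes {j₀ = j₀} {j} {pairFlip c d} {i} λ j≡j₀ →
    pairFlip-fixes [ off-pair ε y≢+c y≢-c j≡j₀ , i≢d ]′
  g-flips-c : to g +c ≡ -c
  g-flips-c = cong (λ s → ((s , c) , j₀)) (¬T⇒·≡not true w-flips-c)
  g-fixes-y : to g y ≡ y
  g-fixes-y = cong (λ s → ((s , i) , j)) (T⇒·-identityʳ ε w-fixes-y)

proposition3p15 : (m k : ℕ) → 2 ≤ m → 1 ≤ k →
    (Γ : Graph (V m k)) → VertexTransitive Γ →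
    (G : Perm (V m k) → Set) → IsSubgroup G →
    (Y : Perm (D m) → Set) → IsSubgroup Y →
    (∀ y → Y y → InC2wrSym m y) →
    (∀ p → InEk m k p → G p) →
    (∀ p → G p → InWr m k Y p) →
    (∀ p → G p → IsAut Γ p) →
    3 ≤ m → MotionIs m k Γ 2
proposition3p15 m k _ 1≤k Γ _ _ _ _ _ _ Eᵏ≤G _ G≤Aut 3≤m =
  (transposition , τ-isAut , (+c , transposition-moves-a +c≢-c) , moved-transposition +c≢-c) ,
  λ p _ → moved-≥2 p
  where
  c : Fin m
  c = fromℕ< (<-≤-trans z<s 3≤m)
  j₀ : Fin k
  j₀ = fromℕ< 1≤k
  +c -c : V m k
  +c = ((true , c) , j₀)
  -c = ((false , c) , j₀)
  +c≢-c : +c ≢ -c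
  +c≢-c ()
  open Transposition _≟V_ +c -c
  τ-isAut : IsAut Γ transposition
  τ-isAut = transposition-isAut Γ (signed-twins Γ (λ p → G≤Aut p ∘ Eᵏ≤G p) 3≤m j₀ c)
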